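{- Let $1\leq k\leq n-3$ and let $v_0$ be the pendant vertex of the path-star tree $P_{k+1,n-k-1}$ lying on its path part. Then $f_{P_{k+1,n-k-1}}(v_0)=\min\{f_T(v): T\in\mathfrak{T}_{n,k},\ v\in V(T)\}$, and $f_{P_{k+1,n-k-1}}(v_0)=2^{n-k-1}+k$.
   Context: $f_G(v)$ is the number of connected subgraphs of $G$ containing $v$ (for a tree, the number of subtrees containing $v$). $\mathfrak{T}_{n,k}$ is the set of trees on $n$ vertices with exactly $k$ cut vertices. The path-star tree $P_{m,r}$ is obtained by identifying one end vertex of the path $P_m$ with the center of the star $K_{1,r}$; its pendant vertex lying on the path part is the other end vertex of $P_m$. -}

module Defs where

open import Data.Bool using (Bool; true; false; _∧_; _∨_; not; if_then_else_)
open import Data.Nat using (ℕ; zero; suc; _∸_; _+_; _≡ᵇ_; _<ᵇ_)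
open import Data.Fin using (Fin; toℕ; _≟_)
open import Data.List using (List; []; _∷_; length; filterᵇ; map; concatMap; allFin)
open import Data.Bool.ListAction using (any; all)
open import Data.Nat.ListAction using (sum)
open import Data.Vec using (Vec; []; _∷_; lookup)
open import Data.Product using (_×_; _,_)
open import Relation.Nullary.Decidable using (⌊_⌋)
open import Relation.Binary.PropositionalEquality using (_≡_)

Graph : ℕ → Set
Graph n = Fin n → Fin n → Bool

VSet : ℕ → Set
VSet n = Fin n → Bool

IsSimple : ∀ {n} → Graph n → Set
IsSimple {n} G = (∀ (i j : Fin n) → G i j ≡ G j i) × (∀ (i : Fin n) → G i i ≡ false)

anyV : ∀ {n} → (Fin n → Bool) → Bool
anyV {n} p = any p (allFin n)

allV : ∀ {n} → (Fin n → Bool) → Bool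
allV {n} p = all p (allFin n)

countV : ∀ {n} → (Fin n → Bool) → ℕ
countV {n} p = length (filterᵇ p (allFin n))

-- reachWithin G S x k y : y is reachable from x by a walk of length ≤ k
-- all of whose vertices lie in S (i.e. a walk in the induced subgraph G[S]).
reachWithin : ∀ {n} → Graph n → VSet n → Fin n → ℕ → VSet n
reachWithin G S x zero y = S x ∧ S y ∧ ⌊ x ≟ y ⌋
reachWithin G S x (suc k) y =
  reachWithin G S x k y ∨ (S y ∧ anyV (λ z → reachWithin G S x k z ∧ G z y))

-- Reachability in G[S]: a walk exists iff one of length < n exists.
reach : ∀ {n} → Graph n → VSet n → Fin n → Fin n → Bool
reach {n} G S x y = reachWithin G S x n y

connectedᵇ : ∀ {n} → Graph n → VSet n → Bool
connectedᵇ G S = allV (λ x → allV (λ y → not (S x ∧ S y) ∨ reach G S x y))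

fullSet : ∀ {n} → VSet n
fullSet _ = true

edgeCount : ∀ {n} → Graph n → ℕ
edgeCount {n} G = sum (map (λ i → countV (λ j → (toℕ i <ᵇ toℕ j) ∧ G i j)) (allFin n))

-- A tree: a simple connected graph on n vertices with n - 1 edges
-- (equivalently, connected and acyclic).
IsTree : ∀ {n} → Graph n → Set
IsTree {n} G = IsSimple G × (connectedᵇ G fullSet ≡ true) × (edgeCount G ≡ n ∸ 1)

-- v is a cut vertex of G: deleting v increases the number of components,
-- i.e. some two vertices other than v are joined by a walk in G
-- but not by a walk in G - v.
isCutVertex : ∀ {n} → Graph n → Fin n → Bool
isCutVertex G v =
  anyV (λ x → anyV (λ y →
    not ⌊ x ≟ v ⌋ ∧ not ⌊ y ≟ v ⌋ ∧ reach G fullSet x y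
      ∧ not (reach G (λ z → not ⌊ z ≟ v ⌋) x y)))

numCutVertices : ∀ {n} → Graph n → ℕ
numCutVertices G = countV (isCutVertex G)

InTnk : (n k : ℕ) → Graph n → Set
InTnk n k T = IsTree T × (numCutVertices T ≡ k)

allVecs : ∀ n → List (Vec Bool n)
allVecs zero = [] ∷ []
allVecs (suc n) = concatMap (λ xs → (true ∷ xs) ∷ (false ∷ xs) ∷ []) (allVecs n)

-- f_G(v): number of vertex sets S ∋ v with G[S] connected
-- (= number of connected subgraphs / subtrees containing v, for a tree G).
f : ∀ {n} → Graph n → Fin n → ℕ
f {n} G v = length (filterᵇ (λ xs → lookup xs v ∧ connectedᵇ G (lookup xs)) (allVecs n))

-- Path-star tree on Fin n with path part of m vertices: vertices 0,…,m-1 form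
-- the path P_m (0 is its free end, m-1 the star centre), and the vertices
-- m,…,n-1 are the n-m leaves of the star K_{1,n-m} centred at m-1.
-- Thus pathStar n m is P_{m,n-m}.
pathStar : (n m : ℕ) → Graph n
pathStar n m i j = pathEdge ∨ starEdge a b ∨ starEdge b a
  where
  a = toℕ i
  b = toℕ j
  pathEdge = (a <ᵇ m) ∧ (b <ᵇ m) ∧ ((suc a ≡ᵇ b) ∨ (suc b ≡ᵇ a))
  starEdge : ℕ → ℕ → Bool
  starEdge x y = (x ≡ᵇ (m ∸ 1)) ∧ not (y <ᵇ m)

-- The path-star tree is a tree whose cut vertices are exactly its inner path vertices 1, …, k.
-- Conversely let T be a tree with k cut vertices and v a vertex. A vertex w of T with two
-- distinct neighbours is a cut vertex, since otherwise a breadth-first spanning tree of T − w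
-- together with two edges at w would give n edges. So in a breadth-first tree from v every
-- parent other than v is a cut vertex, and every vertex set containing v and all cut vertices
-- induces a subtree: 2^(n − |D|) subtrees, where D is the set of cut vertices together with v.
-- Each cut vertex c ≠ v contributes one more subtree, the component of T − c containing v, and
-- distinct c give distinct components. Hence f_T(v) ≥ 2^(n−k−1) + k. In the path-star tree a
-- subtree containing the end vertex v₀ either contains the whole path 0, …, k (2^(n−k−1)
-- choices of leaves) or is one of the k initial segments {0, …, j} with j < k, so the bound is
-- attained there.

module Submission where

open import Defs

import Data.Bool as Bool
open import Data.Bool using (Bool; true; false; _∧_; _∨_; not; T; if_then_else_)
open import Data.Bool.ListAction using (all)
open import Data.Bool.Properties
  using (∧-conicalˡ; ∧-conicalʳ; ∧-zeroʳ; ∨-identityʳ; not-injective; ¬-not; T-≡)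
open import Data.Empty using (⊥; ⊥-elim)
open import Data.Fin as Fin using (Fin; toℕ; _≟_)
open import Data.Fin.Properties
  using (any?; toℕ-injective; toℕ-fromℕ<; toℕ-inject; ¬∀⟶∃¬-smallest)
open import Data.List
  using (List; []; _∷_; _++_; length; map; filterᵇ; concatMap; tabulate; allFin; upTo)
open import Data.List.Properties
  using (length-filter; length-upTo; length-removeAt′; length-++; length-map; length-tabulate;
         map-cong; map-tabulate)
open import Data.List.Membership.Propositional using (_∈_)
open import Data.List.Membership.Propositional.Properties
  using (∈-upTo⁺; ∈-allFin; ∈-map⁺; ∈-map⁻; ∈-++⁻; ∈-filter⁺; ∈-filter⁻; ∈-concatMap⁺; ∈-concatMap⁻)
open import Data.List.Relation.Unary.All as All using ([]; _∷_)
import Data.List.Relation.Unary.All.Properties as AllP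
open import Data.List.Relation.Unary.AllPairs using ([]; _∷_)
open import Data.List.Relation.Unary.Any as Any using (here; there; _─_; index)
open import Data.List.Relation.Unary.Any.Properties using (any⁺; any⁻)
open import Data.List.Relation.Unary.Unique.Propositional using (Unique)
open import Data.List.Relation.Unary.Unique.Propositional.Properties using (filter⁺; allFin⁺; ++⁺)
open import Data.Nat
  using (ℕ; zero; suc; pred; _+_; _∸_; _^_; _<ᵇ_; _≡ᵇ_; _≤_; _<_; _≤′_; ≤′-refl; ≤′-step;
         z≤n; s≤s; s≤s⁻¹; z<s; s<s; s<s⁻¹; NonZero; ≢-nonZero)
open import Data.Nat.ListAction using (sum)
open import Data.Nat.Properties hiding (_≟_)
open import Algebra.Properties.CommutativeSemigroup +-commutativeSemigroup
  using () renaming (interchange to +-interchange)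
open import Data.Product using (Σ; _×_; _,_; proj₁; proj₂)
open import Data.Sum using (_⊎_; inj₁; inj₂)
import Data.Vec as Vec
open import Data.Vec using (Vec; []; _∷_; lookup)
open import Data.Vec.Properties using (lookup∘tabulate; tabulate∘lookup; tabulate-cong)
open import Function using (_∘_; id)
open import Function.Bundles using (Equivalence)
open import Relation.Binary.PropositionalEquality
  using (_≡_; _≢_; refl; sym; trans; cong; cong₂; subst; module ≡-Reasoning)
open import Relation.Nullary using (¬_; yes; no)
open import Relation.Nullary.Decidable using (⌊_⌋; T?)

private variable
  A B : Set
  n : ℕ

-- Boolean reflection

∧-elim : ∀ a {b} → a ∧ b ≡ true → a ≡ true × b ≡ true
∧-elim a {b} e = ∧-conicalˡ a b e , ∧-conicalʳ a b e

∧-intro : ∀ {a b} → a ≡ true → b ≡ true → a ∧ b ≡ true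
∧-intro refl refl = refl

∨-elim : ∀ a {b} → a ∨ b ≡ true → a ≡ true ⊎ b ≡ true
∨-elim true _ = inj₁ refl
∨-elim false e = inj₂ e

∨-introˡ : ∀ {a} b → a ≡ true → a ∨ b ≡ true
∨-introˡ _ refl = refl

∨-introʳ : ∀ a {b} → b ≡ true → a ∨ b ≡ true
∨-introʳ true _ = refl
∨-introʳ false e = e

true≢false : ∀ {a} → a ≡ true → a ≡ false → ⊥
true≢false refl ()

true⇔true⇒≡ : ∀ {a b} → (a ≡ true → b ≡ true) → (b ≡ true → a ≡ true) → a ≡ b
true⇔true⇒≡ {false} {false} _ _ = refl
true⇔true⇒≡ {false} {true} _ b⇒a = b⇒a refl
true⇔true⇒≡ {true} a⇒b _ = sym (a⇒b refl)

≡true⇒T : ∀ {a} → a ≡ true → T a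
≡true⇒T = Equivalence.from T-≡

T⇒≡true : ∀ {a} → T a → a ≡ true
T⇒≡true = Equivalence.to T-≡

≟-true⇒≡ : {x y : Fin n} → ⌊ x ≟ y ⌋ ≡ true → x ≡ y
≟-true⇒≡ {x = x} {y} e with x ≟ y
... | yes x≡y = x≡y
... | no _ = ⊥-elim (true≢false e refl)

≡⇒≟-true : {x y : Fin n} → x ≡ y → ⌊ x ≟ y ⌋ ≡ true
≡⇒≟-true {x = x} {y} x≡y with x ≟ y
... | yes _ = refl
... | no x≢y = ⊥-elim (x≢y x≡y)

≢⇒≟-false : {x y : Fin n} → x ≢ y → ⌊ x ≟ y ⌋ ≡ false
≢⇒≟-false x≢y = ¬-not (x≢y ∘ ≟-true⇒≡)

≟-false⇒≢ : {x y : Fin n} → ⌊ x ≟ y ⌋ ≡ false → x ≢ y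
≟-false⇒≢ e x≡y = true≢false (≡⇒≟-true x≡y) e

<ᵇ-true⇒< : ∀ m n → (m <ᵇ n) ≡ true → m < n
<ᵇ-true⇒< m n e = <ᵇ⇒< m n (≡true⇒T e)

<⇒<ᵇ-true : ∀ {m n} → m < n → (m <ᵇ n) ≡ true
<⇒<ᵇ-true m<n = T⇒≡true (<⇒<ᵇ m<n)

<ᵇ-false⇒≥ : ∀ {m n} → (m <ᵇ n) ≡ false → n ≤ m
<ᵇ-false⇒≥ e = ≮⇒≥ (λ m<n → true≢false (<⇒<ᵇ-true m<n) e)

≥⇒<ᵇ-false : ∀ {m n} → n ≤ m → (m <ᵇ n) ≡ false
≥⇒<ᵇ-false n≤m = ¬-not (λ e → ≤⇒≯ n≤m (<ᵇ-true⇒< _ _ e))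

≡ᵇ-true⇒≡ : ∀ m n → (m ≡ᵇ n) ≡ true → m ≡ n
≡ᵇ-true⇒≡ m n e = ≡ᵇ⇒≡ m n (≡true⇒T e)

≡ᵇ-refl : ∀ m → (m ≡ᵇ m) ≡ true
≡ᵇ-refl m = T⇒≡true (≡⇒≡ᵇ m m refl)

-- Counting

bit : Bool → ℕ
bit true = 1
bit false = 0

count : (A → Bool) → List A → ℕ
count p xs = length (filterᵇ p xs)

count-∷ : ∀ (p : A → Bool) x xs → count p (x ∷ xs) ≡ bit (p x) + count p xs
count-∷ p x xs with p x
... | true = refl
... | false = refl

count-mono : ∀ (p q : A → Bool) xs → (∀ x → p x ≡ true → q x ≡ true) → count p xs ≤ count q xs
count-mono p q [] _ = z≤n
count-mono p q (x ∷ xs) p⇒q rewrite count-∷ p x xs | count-∷ q x xs with p x in px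
... | true rewrite p⇒q x px = s≤s (count-mono p q xs p⇒q)
... | false = ≤-trans (count-mono p q xs p⇒q) (m≤n+m _ (bit (q x)))

count-strict-mono : ∀ (p q : A → Bool) {xs y} → (∀ x → p x ≡ true → q x ≡ true) →
                    y ∈ xs → q y ≡ true → p y ≡ false → count p xs < count q xs
count-strict-mono p q {y ∷ xs} p⇒q (here refl) qy py
  rewrite count-∷ p y xs | count-∷ q y xs | qy | py = s≤s (count-mono p q xs p⇒q)
count-strict-mono p q {x ∷ xs} p⇒q (there y∈xs) qy py
  rewrite count-∷ p x xs | count-∷ q x xs with p x in px
... | true rewrite p⇒q x px = s≤s (count-strict-mono p q p⇒q y∈xs qy py)
... | false = ≤-trans (count-strict-mono p q p⇒q y∈xs qy py) (m≤n+m _ (bit (q x)))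

count-cong : ∀ (p q : A → Bool) xs → (∀ x → p x ≡ q x) → count p xs ≡ count q xs
count-cong p q xs p≗q = ≤-antisym (count-mono p q xs (λ x e → trans (sym (p≗q x)) e))
                                   (count-mono q p xs (λ x e → trans (p≗q x) e))

count-partition : ∀ (p q : A → Bool) xs →
                  count p xs ≡ count (λ x → p x ∧ q x) xs + count (λ x → p x ∧ not (q x)) xs
count-partition p q [] = refl
count-partition p q (x ∷ xs)
  rewrite count-∷ p x xs | count-∷ (λ x → p x ∧ q x) x xs | count-∷ (λ x → p x ∧ not (q x)) x xs
  with p x | q x
... | true | true = cong suc (count-partition p q xs)
... | true | false = trans (cong suc (count-partition p q xs)) (sym (+-suc _ _))
... | false | _ = count-partition p q xs

count-map : ∀ (p : B → Bool) (g : A → B) xs → count p (map g xs) ≡ count (p ∘ g) xs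
count-map p g [] = refl
count-map p g (x ∷ xs) = trans (count-∷ p (g x) (map g xs))
  (trans (cong (bit (p (g x)) +_) (count-map p g xs)) (sym (count-∷ (p ∘ g) x xs)))

∈-filterᵇ⁺ : ∀ (p : A → Bool) {x xs} → x ∈ xs → p x ≡ true → x ∈ filterᵇ p xs
∈-filterᵇ⁺ p x∈xs px = ∈-filter⁺ (T? ∘ p) x∈xs (≡true⇒T px)

∈-filterᵇ⁻ : ∀ (p : A → Bool) {x xs} → x ∈ filterᵇ p xs → x ∈ xs × p x ≡ true
∈-filterᵇ⁻ p x∈ = let x∈xs , px = ∈-filter⁻ (T? ∘ p) x∈ in x∈xs , T⇒≡true px

count-true : ∀ (xs : List A) → count (λ _ → true) xs ≡ length xs
count-true [] = refl
count-true (x ∷ xs) = cong suc (count-true xs)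

count-false : ∀ (xs : List A) → count (λ _ → false) xs ≡ 0
count-false [] = refl
count-false (x ∷ xs) = count-false xs

∈-─⁺ : ∀ {x z : A} {ys} (x∈ys : x ∈ ys) → z ∈ ys → z ≢ x → z ∈ (ys ─ x∈ys)
∈-─⁺ (here refl) (here refl) z≢x = ⊥-elim (z≢x refl)
∈-─⁺ (here _) (there z∈ys) _ = z∈ys
∈-─⁺ (there _) (here refl) _ = here refl
∈-─⁺ (there x∈ys) (there z∈ys) z≢x = there (∈-─⁺ x∈ys z∈ys z≢x)

unique-⊆⇒length≤ : ∀ {xs ys : List A} → Unique xs → (∀ {z} → z ∈ xs → z ∈ ys) →
                   length xs ≤ length ys
unique-⊆⇒length≤ [] _ = z≤n
unique-⊆⇒length≤ {xs = x ∷ xs} {ys} (x≢xs ∷ xs-unique) xs⊆ys = begin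
  suc (length xs)          ≤⟨ s≤s (unique-⊆⇒length≤ xs-unique xs⊆ys─x) ⟩
  suc (length (ys ─ x∈ys)) ≡⟨ length-removeAt′ ys (index x∈ys) ⟨
  length ys                ∎
  where
  open ≤-Reasoning
  x∈ys : x ∈ ys
  x∈ys = xs⊆ys (here refl)
  xs⊆ys─x : ∀ {z} → z ∈ xs → z ∈ (ys ─ x∈ys)
  xs⊆ys─x z∈xs = ∈-─⁺ x∈ys (xs⊆ys (there z∈xs)) (λ z≡x → All.lookup x≢xs z∈xs (sym z≡x))

unique-map-on : ∀ (g : A → B) {xs} → (∀ {x y} → x ∈ xs → y ∈ xs → g x ≡ g y → x ≡ y) →
                Unique xs → Unique (map g xs)
unique-map-on g inj [] = []
unique-map-on g inj (x≢xs ∷ xs-unique) =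
  AllP.map⁺ (All.tabulate λ y∈xs gx≡gy → All.lookup x≢xs y∈xs (inj (here refl) (there y∈xs) gx≡gy))
  ∷ unique-map-on g (λ x∈ y∈ → inj (there x∈) (there y∈)) xs-unique

count≤length : ∀ (p : A → Bool) {xs} ys → Unique xs →
               (∀ {x} → x ∈ xs → p x ≡ true → x ∈ ys) → count p xs ≤ length ys
count≤length p ys xs-unique covered = unique-⊆⇒length≤ (filter⁺ (T? ∘ p) xs-unique) λ x∈ →
  let x∈xs , px = ∈-filterᵇ⁻ p x∈ in covered x∈xs px

length≤count : ∀ (p : A → Bool) {xs} ws → Unique ws →
               (∀ {w} → w ∈ ws → w ∈ xs × p w ≡ true) → length ws ≤ count p xs
length≤count p ws ws-unique ws⊆ = unique-⊆⇒length≤ ws-unique λ w∈ws →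
  let w∈xs , pw = ws⊆ w∈ws in ∈-filterᵇ⁺ p w∈xs pw

countV-suc : ∀ (p : Fin (suc n) → Bool) → countV p ≡ bit (p Fin.zero) + countV (p ∘ Fin.suc)
countV-suc {n} p = begin
  count p (Fin.zero ∷ tabulate Fin.suc)
    ≡⟨ count-∷ p Fin.zero _ ⟩
  bit (p Fin.zero) + count p (tabulate Fin.suc)
    ≡⟨ cong (λ xs → bit (p Fin.zero) + count p xs) (map-tabulate id Fin.suc) ⟨
  bit (p Fin.zero) + count p (map Fin.suc (allFin n))
    ≡⟨ cong (bit (p Fin.zero) +_) (count-map p Fin.suc (allFin n)) ⟩
  bit (p Fin.zero) + countV (p ∘ Fin.suc) ∎
  where open ≡-Reasoning

countV≤n : ∀ (p : Fin n → Bool) → countV p ≤ n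
countV≤n {n} p = ≤-trans (length-filter (T? ∘ p) (allFin n)) (≤-reflexive (length-tabulate id))

countV-≟≤1 : ∀ (w : Fin n) → countV (λ i → ⌊ i ≟ w ⌋) ≤ 1
countV-≟≤1 {n} w = count≤length _ (w ∷ []) (allFin⁺ n) (λ _ e → here (≟-true⇒≡ e))

countV-true : countV {n} (λ _ → true) ≡ n
countV-true {n} = trans (count-true (allFin n)) (length-tabulate id)

countV-remove : ∀ (p : Fin n → Bool) v → countV p ≤ suc (countV (λ i → p i ∧ not ⌊ i ≟ v ⌋))
countV-remove {n} p v = begin
  countV p
    ≡⟨ count-partition p (λ i → ⌊ i ≟ v ⌋) (allFin n) ⟩
  countV (λ i → p i ∧ ⌊ i ≟ v ⌋) + countV (λ i → p i ∧ not ⌊ i ≟ v ⌋)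
    ≤⟨ +-monoˡ-≤ _ at-most-v ⟩
  suc (countV (λ i → p i ∧ not ⌊ i ≟ v ⌋)) ∎
  where
  open ≤-Reasoning
  at-most-v : countV (λ i → p i ∧ ⌊ i ≟ v ⌋) ≤ 1
  at-most-v = ≤-trans (count-mono _ _ (allFin n) λ i e → proj₂ (∧-elim (p i) e)) (countV-≟≤1 v)

sumBelow : (ℕ → ℕ) → ℕ → ℕ
sumBelow g zero = 0
sumBelow g (suc n) = g 0 + sumBelow (g ∘ suc) n

sum-allFin-toℕ : ∀ n (g : ℕ → ℕ) → sum (map (g ∘ toℕ) (allFin n)) ≡ sumBelow g n
sum-allFin-toℕ n g = trans (cong sum (map-tabulate {n = n} id (g ∘ toℕ))) (go n g)
  where
  go : ∀ n (g : ℕ → ℕ) → sum (tabulate {n = n} (g ∘ toℕ)) ≡ sumBelow g n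
  go zero g = refl
  go (suc n) g = cong (g 0 +_) (go n (g ∘ suc))

countV-toℕ : ∀ n (p : ℕ → Bool) → countV (p ∘ toℕ {n}) ≡ sumBelow (bit ∘ p) n
countV-toℕ zero p = refl
countV-toℕ (suc n) p = trans (countV-suc (p ∘ toℕ)) (cong (bit (p 0) +_) (countV-toℕ n (p ∘ suc)))

sumBelow-cong : ∀ {g h : ℕ → ℕ} n → (∀ a → a < n → g a ≡ h a) → sumBelow g n ≡ sumBelow h n
sumBelow-cong zero _ = refl
sumBelow-cong (suc n) g≡h = cong₂ _+_ (g≡h 0 z<s) (sumBelow-cong n λ a a<n → g≡h (suc a) (s<s a<n))

sumBelow-zero : ∀ {g : ℕ → ℕ} n → (∀ a → g a ≡ 0) → sumBelow g n ≡ 0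
sumBelow-zero zero _ = refl
sumBelow-zero {g} (suc n) g≡0 rewrite g≡0 0 = sumBelow-zero n (g≡0 ∘ suc)

sumBelow-<ᵇ : ∀ {m n} → m ≤ n → sumBelow (λ a → bit (a <ᵇ m)) n ≡ m
sumBelow-<ᵇ {zero} {n} _ = sumBelow-zero n λ _ → refl
sumBelow-<ᵇ {suc m} {suc n} (s≤s m≤n) = cong suc (sumBelow-<ᵇ m≤n)

sumBelow-≡ᵇ : ∀ {c n} → c < n → sumBelow (λ a → bit (a ≡ᵇ c)) n ≡ 1
sumBelow-≡ᵇ {zero} {suc n} _ = cong suc (sumBelow-zero n λ _ → refl)
sumBelow-≡ᵇ {suc c} {suc n} (s<s c<n) = sumBelow-≡ᵇ c<n

sumBelow->ᵇ : ∀ c n → sumBelow (λ a → bit (c <ᵇ a)) n ≡ n ∸ suc c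
sumBelow->ᵇ c zero = refl
sumBelow->ᵇ zero (suc n) = trans (sumBelow-cong n λ a a<n → cong bit (sym (<⇒<ᵇ-true a<n))) (sumBelow-<ᵇ ≤-refl)
sumBelow->ᵇ (suc c) (suc n) = sumBelow->ᵇ c n

sumBelow-shape : ∀ {g : ℕ → ℕ} {m n c} → m < n →
                 (∀ a → a < m → g a ≡ 1) → g m ≡ c → (∀ a → m < a → g a ≡ 0) → sumBelow g n ≡ m + c
sumBelow-shape {g} {zero} {suc n} {c} _ _ gm≡c above =
  trans (cong₂ _+_ gm≡c (sumBelow-zero n λ a → above (suc a) z<s)) (+-identityʳ c)
sumBelow-shape {g} {suc m} {suc n} (s<s m<n) below gm≡c above = cong₂ _+_ (below 0 z<s)
  (sumBelow-shape m<n (λ a a<m → below (suc a) (s<s a<m)) gm≡c (λ a m<a → above (suc a) (s<s m<a)))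

least-missing : ∀ (X : Fin n → Bool) i → X i ≡ false →
                Σ (Fin n) λ m → X m ≡ false × (∀ u → toℕ u < toℕ m → X u ≡ true)
least-missing {n} X i Xi≡false
  with ¬∀⟶∃¬-smallest n (λ u → X u ≡ true) (λ u → X u Bool.≟ true) (λ all → true≢false (all i) Xi≡false)
... | m , Xm≢true , smaller = m , ¬-not Xm≢true , λ u u<m →
  subst (λ z → X z ≡ true) (toℕ-injective (trans (toℕ-inject (Fin.fromℕ< u<m)) (toℕ-fromℕ< u<m)))
        (smaller (Fin.fromℕ< u<m))

countSubsets : (Vec Bool n → Bool) → ℕ
countSubsets {n} P = count P (allVecs n)

-- Subsets of Fin n as Boolean vectors

extensions : Vec Bool n → List (Vec Bool (suc n))
extensions X = (true ∷ X) ∷ (false ∷ X) ∷ []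

∈-allVecs : (X : Vec Bool n) → X ∈ allVecs n
∈-allVecs [] = here refl
∈-allVecs (true ∷ X) = ∈-concatMap⁺ extensions (Any.map (λ { refl → here refl }) (∈-allVecs X))
∈-allVecs (false ∷ X) = ∈-concatMap⁺ extensions (Any.map (λ { refl → there (here refl) }) (∈-allVecs X))

∈-concatMap-extensions⁻ : ∀ {X : Vec Bool (suc n)} ys → X ∈ concatMap extensions ys → Vec.tail X ∈ ys
∈-concatMap-extensions⁻ ys X∈ = Any.map tail≡ (∈-concatMap⁻ extensions X∈)
  where
  tail≡ : ∀ {X Y} → X ∈ extensions Y → Vec.tail X ≡ Y
  tail≡ (here refl) = refl
  tail≡ (there (here refl)) = refl

concatMap-extensions-unique : ∀ {ys : List (Vec Bool n)} → Unique ys → Unique (concatMap extensions ys)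
concatMap-extensions-unique [] = []
concatMap-extensions-unique {ys = y ∷ ys} (y∉ys ∷ ys-unique) =
  ((λ ()) ∷ fresh true) ∷ fresh false ∷ concatMap-extensions-unique ys-unique
  where
  fresh : ∀ b → All.All ((b ∷ y) ≢_) (concatMap extensions ys)
  fresh b = All.tabulate λ Z∈ b∷y≡Z → All.lookup y∉ys (∈-concatMap-extensions⁻ ys Z∈) (cong Vec.tail b∷y≡Z)

allVecs-unique : ∀ n → Unique (allVecs n)
allVecs-unique zero = [] ∷ []
allVecs-unique (suc n) = concatMap-extensions-unique (allVecs-unique n)

count-concatMap-extensions : ∀ (P : Vec Bool (suc n) → Bool) ys →
  count P (concatMap extensions ys) ≡ count (P ∘ (true ∷_)) ys + count (P ∘ (false ∷_)) ys
count-concatMap-extensions P [] = refl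
count-concatMap-extensions P (y ∷ ys) = begin
  count P ((true ∷ y) ∷ (false ∷ y) ∷ concatMap extensions ys)
    ≡⟨ trans (count-∷ P _ _) (cong (bit t +_) (count-∷ P _ _)) ⟩
  bit t + (bit u + count P (concatMap extensions ys))
    ≡⟨ cong (λ c → bit t + (bit u + c)) (count-concatMap-extensions P ys) ⟩
  bit t + (bit u + (count (P ∘ (true ∷_)) ys + count (P ∘ (false ∷_)) ys))
    ≡⟨ +-assoc (bit t) (bit u) _ ⟨
  (bit t + bit u) + (count (P ∘ (true ∷_)) ys + count (P ∘ (false ∷_)) ys)
    ≡⟨ +-interchange (bit t) (bit u) _ _ ⟩
  (bit t + count (P ∘ (true ∷_)) ys) + (bit u + count (P ∘ (false ∷_)) ys)
    ≡⟨ cong₂ _+_ (count-∷ (P ∘ (true ∷_)) y ys) (count-∷ (P ∘ (false ∷_)) y ys) ⟨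
  count (P ∘ (true ∷_)) (y ∷ ys) + count (P ∘ (false ∷_)) (y ∷ ys) ∎
  where
  open ≡-Reasoning
  t u : Bool
  t = P (true ∷ y)
  u = P (false ∷ y)

countSubsets-suc : ∀ (P : Vec Bool (suc n) → Bool) →
  countSubsets P ≡ countSubsets (P ∘ (true ∷_)) + countSubsets (P ∘ (false ∷_))
countSubsets-suc {n} P = count-concatMap-extensions P (allVecs n)

infix 7 _⊆ᵇ_
_⊆ᵇ_ : (Fin n → Bool) → Vec Bool n → Bool
_⊆ᵇ_ {zero} D [] = true
_⊆ᵇ_ {suc n} D (x ∷ X) = (not (D Fin.zero) ∨ x) ∧ (D ∘ Fin.suc ⊆ᵇ X)

countSubsets-⊇ : ∀ (D : Fin n → Bool) → countSubsets (D ⊆ᵇ_) ≡ 2 ^ (n ∸ countV D)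
countSubsets-⊇ {zero} D = refl
countSubsets-⊇ {suc n} D rewrite countSubsets-suc (D ⊆ᵇ_) | countV-suc D with D Fin.zero
... | true = begin
  countSubsets (D ∘ Fin.suc ⊆ᵇ_) + count (λ _ → false) (allVecs n)
    ≡⟨ cong₂ _+_ (countSubsets-⊇ (D ∘ Fin.suc)) (count-false (allVecs n)) ⟩
  2 ^ (n ∸ countV (D ∘ Fin.suc)) + 0
    ≡⟨ +-identityʳ _ ⟩
  2 ^ (n ∸ countV (D ∘ Fin.suc)) ∎
  where open ≡-Reasoning
... | false = begin
  countSubsets (D ∘ Fin.suc ⊆ᵇ_) + countSubsets (D ∘ Fin.suc ⊆ᵇ_)
    ≡⟨ cong (λ c → c + c) (countSubsets-⊇ (D ∘ Fin.suc)) ⟩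
  2 ^ (n ∸ c) + 2 ^ (n ∸ c)
    ≡⟨ cong (2 ^ (n ∸ c) +_) (+-identityʳ _) ⟨
  2 ^ suc (n ∸ c)
    ≡⟨ cong (2 ^_) (+-∸-assoc 1 (countV≤n (D ∘ Fin.suc))) ⟨
  2 ^ (suc n ∸ c) ∎
  where
  open ≡-Reasoning
  c = countV (D ∘ Fin.suc)

⊆ᵇ-sound : ∀ {D : Fin n → Bool} X → D ⊆ᵇ X ≡ true → ∀ i → D i ≡ true → lookup X i ≡ true
⊆ᵇ-sound {D = D} (x ∷ X) D⊆X Fin.zero Di with ∧-elim (not (D Fin.zero) ∨ x) D⊆X
... | head , _ rewrite Di = head
⊆ᵇ-sound {D = D} (x ∷ X) D⊆X (Fin.suc i) Di = ⊆ᵇ-sound X (proj₂ (∧-elim (not (D Fin.zero) ∨ x) D⊆X)) i Di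

⊈ᵇ-witness : ∀ {D : Fin n → Bool} X → D ⊆ᵇ X ≡ false → Σ (Fin n) λ i → D i ≡ true × lookup X i ≡ false
⊈ᵇ-witness {D = D} (x ∷ X) D⊈X with D Fin.zero in D0 | x
... | true | false = Fin.zero , D0 , refl
... | true | true = let i , Di , Xi = ⊈ᵇ-witness X D⊈X in Fin.suc i , Di , Xi
... | false | _ = let i , Di , Xi = ⊈ᵇ-witness X D⊈X in Fin.suc i , Di , Xi

anyV-intro : ∀ (p : Fin n → Bool) x → p x ≡ true → anyV p ≡ true
anyV-intro {n} p x px = T⇒≡true (any⁺ {xs = allFin n} p (Any.map (λ { refl → ≡true⇒T px }) (∈-allFin x)))

anyV-elim : ∀ (p : Fin n → Bool) → anyV p ≡ true → Σ (Fin n) λ x → p x ≡ true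
anyV-elim {n} p e = let x , px = Any.satisfied (any⁻ p (allFin n) (≡true⇒T e)) in x , T⇒≡true px

anyV-false⁺ : ∀ (p : Fin n → Bool) → (∀ x → p x ≡ false) → anyV p ≡ false
anyV-false⁺ p none = ¬-not λ e → let x , px = anyV-elim p e in true≢false px (none x)

anyV-false⁻ : ∀ (p : Fin n → Bool) x → anyV p ≡ false → p x ≡ false
anyV-false⁻ p x e = ¬-not λ px → true≢false (anyV-intro p x px) e

all-intro : ∀ (p : A → Bool) xs → (∀ x → p x ≡ true) → all p xs ≡ true
all-intro p [] _ = refl
all-intro p (x ∷ xs) every rewrite every x = all-intro p xs every

all-elim : ∀ (p : A → Bool) {x xs} → x ∈ xs → all p xs ≡ true → p x ≡ true
all-elim p {xs = y ∷ _} (here refl) e = proj₁ (∧-elim (p y) e)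
all-elim p {xs = y ∷ _} (there x∈xs) e = all-elim p x∈xs (proj₂ (∧-elim (p y) e))

allV-intro : ∀ (p : Fin n → Bool) → (∀ x → p x ≡ true) → allV p ≡ true
allV-intro {n} p = all-intro p (allFin n)

allV-elim : ∀ (p : Fin n → Bool) x → allV p ≡ true → p x ≡ true
allV-elim p x = all-elim p (∈-allFin x)

-- Walks inside a vertex set

least : (ℕ → Bool) → ℕ → ℕ
least P zero = 0
least P (suc m) = if P 0 then 0 else suc (least (P ∘ suc) m)

least-≤ : ∀ (P : ℕ → Bool) m → least P m ≤ m
least-≤ P zero = z≤n
least-≤ P (suc m) with P 0
... | true = z≤n
... | false = s≤s (least-≤ (P ∘ suc) m)

least-minimal : ∀ (P : ℕ → Bool) m {j} → P j ≡ true → least P m ≤ j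
least-minimal P zero _ = z≤n
least-minimal P (suc m) {j} Pj with P 0 in P0 | j
... | true | _ = z≤n
... | false | zero = ⊥-elim (true≢false Pj P0)
... | false | suc j = s≤s (least-minimal (P ∘ suc) m Pj)

least-satisfies : ∀ (P : ℕ → Bool) m {j} → P j ≡ true → j ≤ m → P (least P m) ≡ true
least-satisfies P m {zero} P0 _ with m
... | zero = P0
... | suc m rewrite P0 = P0
least-satisfies P (suc m) {suc j} Pj (s≤s j≤m) with P 0 in P0
... | true = P0
... | false = least-satisfies (P ∘ suc) m Pj j≤m

module Walks (G : Graph n) where

  -- A record rather than a synonym, so that its indices can be inferred.
  record Walk (S : VSet n) (x : Fin n) (j : ℕ) (y : Fin n) : Set where
    constructor walk
    field holds : reachWithin G S x j y ≡ true

  walk-endpoint : ∀ {S x j y} → Walk S x j y → S y ≡ true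
  walk-endpoint {S} {x} {zero} (walk w) = proj₁ (∧-elim (S _) (proj₂ (∧-elim (S x) w)))
  walk-endpoint {S} {x} {suc j} {y} (walk w) with ∨-elim (reachWithin G S x j y) w
  ... | inj₁ w′ = walk-endpoint {S} {x} {j} (walk w′)
  ... | inj₂ step = proj₁ (∧-elim (S y) step)

  walk-refl : ∀ {S x} → S x ≡ true → Walk S x 0 x
  walk-refl Sx = walk (∧-intro Sx (∧-intro Sx (≡⇒≟-true refl)))

  walk-zero⁻ : ∀ {S x y} → Walk S x 0 y → x ≡ y
  walk-zero⁻ {S} {x} {y} (walk w) = ≟-true⇒≡ (proj₂ (∧-elim (S y) (proj₂ (∧-elim (S x) w))))

  walk-suc : ∀ {S x j y} → Walk S x j y → Walk S x (suc j) y
  walk-suc (walk w) = walk (∨-introˡ _ w)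

  walk-mono : ∀ {S x j k y} → j ≤ k → Walk S x j y → Walk S x k y
  walk-mono j≤k = go (≤⇒≤′ j≤k)
    where
    go : ∀ {S x j k y} → j ≤′ k → Walk S x j y → Walk S x k y
    go ≤′-refl w = w
    go (≤′-step j≤k) w = walk-suc (go j≤k w)

  walk-snoc : ∀ {S x j z y} → Walk S x j z → G z y ≡ true → S y ≡ true → Walk S x (suc j) y
  walk-snoc {S} {x} {j} {z} {y} (walk w) g Sy =
    walk (∨-introʳ (reachWithin G S x j y) (∧-intro Sy (anyV-intro _ z (∧-intro w g))))

  walk-last : ∀ {S x j y} → Walk S x (suc j) y →
              Walk S x j y ⊎ Σ (Fin n) λ z → Walk S x j z × G z y ≡ true × S y ≡ true
  walk-last {S} {x} {j} {y} (walk w) with ∨-elim (reachWithin G S x j y) w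
  ... | inj₁ w′ = inj₁ (walk w′)
  ... | inj₂ step with ∧-elim (S y) step
  ... | Sy , some with anyV-elim _ some
  ... | z , wz∧g = let wz , g = ∧-elim (reachWithin G S x j z) wz∧g in inj₂ (z , walk wz , g , Sy)

  walk-cons : ∀ {S x z j y} → S x ≡ true → G x z ≡ true → Walk S z j y → Walk S x (suc j) y
  walk-cons {j = zero} Sx g w with walk-zero⁻ w
  ... | refl = walk-snoc (walk-refl Sx) g (walk-endpoint w)
  walk-cons {j = suc j} Sx g w with walk-last w
  ... | inj₁ w′ = walk-suc (walk-cons Sx g w′)
  ... | inj₂ (u , wu , g′ , Sy) = walk-snoc (walk-cons Sx g wu) g′ Sy

  walk-invariant : ∀ {S x j y} (C : Fin n → Bool) → C x ≡ true →
                   (∀ z y → C z ≡ true → G z y ≡ true → S y ≡ true → C y ≡ true) →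
                   Walk S x j y → C y ≡ true
  walk-invariant {j = zero} C Cx closed w with walk-zero⁻ w
  ... | refl = Cx
  walk-invariant {j = suc j} C Cx closed w with walk-last w
  ... | inj₁ w′ = walk-invariant C Cx closed w′
  ... | inj₂ (z , wz , g , Sy) = closed z _ (walk-invariant C Cx closed wz) g Sy

  walk-restrict : ∀ {S x j y} (U : VSet n) → (∀ {j z} → Walk S x j z → U z ≡ true) →
                  Walk S x j y → Walk U x j y
  walk-restrict {j = zero} U inU w with walk-zero⁻ w
  ... | refl = walk-refl (inU w)
  walk-restrict {j = suc j} U inU w with walk-last w
  ... | inj₁ w′ = walk-suc (walk-restrict U inU w′)
  ... | inj₂ (z , wz , g , _) = walk-snoc (walk-restrict U inU wz) g (inU w)

  module _ (S : VSet n) (x : Fin n) where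
    private
      reached : ℕ → Fin n → Bool
      reached j = reachWithin G S x j

      Stable : ℕ → Set
      Stable j = ∀ {y} → Walk S x (suc j) y → Walk S x j y

      stable-forever : ∀ {j} → Stable j → ∀ i {y} → Walk S x (i + j) y → Walk S x j y
      stable-forever stable zero w = w
      stable-forever stable (suc i) w with walk-last w
      ... | inj₁ w′ = stable-forever stable i w′
      ... | inj₂ (z , wz , g , Sy) = stable (walk-snoc (stable-forever stable i wz) g Sy)

      stable-or-growing : ∀ j → Stable j ⊎ Σ (Fin n) λ y → reached (suc j) y ≡ true × reached j y ≡ false
      stable-or-growing j with anyV (λ y → reached (suc j) y ∧ not (reached j y)) in new
      ... | true = let y , q = anyV-elim _ new ; now , before = ∧-elim (reached (suc j) y) q in
                   inj₂ (y , now , not-injective before)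
      ... | false = inj₁ λ {y} (walk w) →
                    walk (not-injective (subst (λ b → b ∧ not (reached j y) ≡ false) w (anyV-false⁻ _ y new)))

      -- Every round that is not stable reaches a new vertex, which can happen at most n times.
      stable-within : ∀ j → Σ ℕ (λ i → i ≤ j × Stable i) ⊎ suc j ≤ countV (reached (suc j))
      stable-within zero with stable-or-growing 0
      ... | inj₁ stable = inj₁ (0 , z≤n , stable)
      ... | inj₂ (y , now , before) =
        inj₂ (≤-trans (s≤s z≤n) (count-strict-mono (reached 0) (reached 1)
                                                   (λ _ → ∨-introˡ _) (∈-allFin y) now before))
      stable-within (suc j) with stable-within j
      ... | inj₁ (i , i≤j , stable) = inj₁ (i , m≤n⇒m≤1+n i≤j , stable)
      ... | inj₂ grown with stable-or-growing (suc j)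
      ... | inj₁ stable = inj₁ (suc j , ≤-refl , stable)
      ... | inj₂ (y , now , before) =
        inj₂ (≤-trans (s≤s grown) (count-strict-mono (reached (suc j)) (reached (suc (suc j)))
                                                     (λ _ → ∨-introˡ _) (∈-allFin y) now before))

    walk⇒reach : ∀ {j y} → Walk S x j y → reach G S x y ≡ true
    walk⇒reach {j} w with stable-within n
    ... | inj₂ n<count = ⊥-elim (<⇒≱ n<count (countV≤n _))
    ... | inj₁ (i , i≤n , stable) = Walk.holds (walk-mono i≤n (stable-forever stable j (walk-mono (m≤m+n j i) w)))

  connected-intro : ∀ S → (∀ {x y} → S x ≡ true → S y ≡ true → reach G S x y ≡ true) → connectedᵇ G S ≡ true
  connected-intro S reachable = allV-intro _ λ x → allV-intro _ λ y → pair x y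
    where
    pair : ∀ x y → not (S x ∧ S y) ∨ reach G S x y ≡ true
    pair x y with S x in Sx | S y in Sy
    ... | true | true = reachable Sx Sy
    ... | true | false = refl
    ... | false | _ = refl

  connected-elim : ∀ {S} → connectedᵇ G S ≡ true → ∀ {x y} → S x ≡ true → S y ≡ true → Walk S x n y
  connected-elim {S} conn {x} {y} Sx Sy with allV-elim _ y (allV-elim _ x conn)
  ... | reachable rewrite Sx | Sy = walk reachable

  module Symmetric (G-sym : ∀ i j → G i j ≡ G j i) where

    walk-sym : ∀ {S x j y} → Walk S x j y → Walk S y j x
    walk-sym {j = zero} w with walk-zero⁻ w
    ... | refl = w
    walk-sym {j = suc j} w with walk-last w
    ... | inj₁ w′ = walk-suc (walk-sym w′)
    ... | inj₂ (z , wz , g , Sy) = walk-cons Sy (trans (G-sym _ z) g) (walk-sym wz)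

    walk-trans : ∀ {S x i y j z} → Walk S x i y → Walk S y j z → Walk S x (i + j) z
    walk-trans {i = i} {j = zero} w w′ with walk-zero⁻ w′
    ... | refl = walk-mono (m≤m+n i 0) w
    walk-trans {S} {x} {i} {j = suc j} {z} w w′ with walk-last w′
    ... | inj₁ w″ = walk-mono (+-monoʳ-≤ i (n≤1+n j)) (walk-trans {j = j} w w″)
    ... | inj₂ (u , wu , g , Sz) =
      subst (λ k → Walk S x k z) (sym (+-suc i j)) (walk-snoc (walk-trans {j = j} w wu) g Sz)

    reach-via-root : ∀ {S r} → (∀ {y} → S y ≡ true → Walk S r n y) →
                     ∀ {x y} → S x ≡ true → S y ≡ true → reach G S x y ≡ true
    reach-via-root {S} {r} from-root Sx Sy = walk⇒reach S _ (walk-trans (walk-sym (from-root Sx)) (from-root Sy))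

    connected-from-root : ∀ {S r} → (∀ {y} → S y ≡ true → Walk S r n y) → connectedᵇ G S ≡ true
    connected-from-root {S} from-root = connected-intro S (reach-via-root from-root)

  module Levels (S : VSet n) (a : Fin n) (from-root : ∀ {y} → S y ≡ true → Walk S a n y) where

    level : Fin n → ℕ
    level y = least (λ j → reachWithin G S a j y) n

    level-walk : ∀ {y} → S y ≡ true → Walk S a (level y) y
    level-walk {y} Sy = walk (least-satisfies (λ j → reachWithin G S a j y) n (Walk.holds (from-root Sy)) ≤-refl)

    level-minimal : ∀ {j y} → Walk S a j y → level y ≤ j
    level-minimal {y = y} (walk w) = least-minimal (λ j → reachWithin G S a j y) n w

    level≤n : ∀ y → level y ≤ n
    level≤n y = least-≤ _ n

    -- The junk value y is never used: parentAt-spec only applies when a neighbour exists.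
    parentAt : ℕ → Fin n → Fin n
    parentAt d y with any? (λ z → T? (reachWithin G S a d z ∧ G z y))
    ... | yes (z , _) = z
    ... | no _ = y

    parentAt-spec : ∀ {d z y} → Walk S a d z → G z y ≡ true →
                    Walk S a d (parentAt d y) × G (parentAt d y) y ≡ true
    parentAt-spec {d} {z} {y} wz g with any? (λ z → T? (reachWithin G S a d z ∧ G z y))
    ... | yes (p , found) = let wp , gp = ∧-elim (reachWithin G S a d p) (T⇒≡true found) in walk wp , gp
    ... | no none = ⊥-elim (none (z , ≡true⇒T (∧-intro (Walk.holds wz) g)))

    parent : Fin n → Fin n
    parent y = parentAt (pred (level y)) y

    level≢0 : ∀ {y} → S y ≡ true → y ≢ a → NonZero (level y)
    level≢0 {y} Sy y≢a = ≢-nonZero λ l≡0 →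
      y≢a (sym (walk-zero⁻ (subst (λ l → Walk S a l y) l≡0 (level-walk Sy))))

    parent-spec : ∀ {y} → S y ≡ true → y ≢ a →
                  G (parent y) y ≡ true × S (parent y) ≡ true × level (parent y) < level y
    parent-spec {y} Sy y≢a
      with walk-last (subst (λ l → Walk S a l y) (sym (suc-pred (level y) {{level≢0 Sy y≢a}})) (level-walk Sy))
    ... | inj₁ w = ⊥-elim (<-irrefl refl (m≤pred[n]⇒suc[m]≤n {{level≢0 Sy y≢a}} (level-minimal w)))
    ... | inj₂ (z , wz , g , _) = let wp , gp = parentAt-spec wz g in
                                  gp , walk-endpoint wp , m≤pred[n]⇒suc[m]≤n {{level≢0 Sy y≢a}} (level-minimal wp)

-- Cut vertices and edges

allBut : Fin n → VSet n
allBut v z = not ⌊ z ≟ v ⌋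

allBut-∋ : ∀ {v z : Fin n} → z ≢ v → allBut v z ≡ true
allBut-∋ z≢v = cong not (≢⇒≟-false z≢v)

allBut-∌ : ∀ {v z : Fin n} → allBut v z ≡ true → z ≢ v
allBut-∌ e = ≟-false⇒≢ (not-injective e)

allBut-self : ∀ (v : Fin n) → allBut v v ≡ false
allBut-self v = cong not (≡⇒≟-true refl)

module _ (G : Graph n) {v : Fin n} where

  cut-intro : ∀ {x y} → x ≢ v → y ≢ v → reach G fullSet x y ≡ true → reach G (allBut v) x y ≡ false →
              isCutVertex G v ≡ true
  cut-intro {x} {y} x≢v y≢v r r-v = anyV-intro _ x (anyV-intro _ y
    (∧-intro (allBut-∋ x≢v) (∧-intro (allBut-∋ y≢v) (∧-intro r (cong not r-v)))))

  nonCut-elim : isCutVertex G v ≡ false → ∀ {x y} → x ≢ v → y ≢ v → reach G fullSet x y ≡ true →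
                reach G (allBut v) x y ≡ true
  nonCut-elim nonCut {x} {y} x≢v y≢v r
    with anyV-false⁻ _ y (anyV-false⁻ _ x nonCut)
  ... | separated rewrite allBut-∋ x≢v | allBut-∋ y≢v | r = not-injective separated

  nonCut-intro : (∀ {x y} → x ≢ v → y ≢ v → reach G (allBut v) x y ≡ true) → isCutVertex G v ≡ false
  nonCut-intro reach-v = anyV-false⁺ _ λ x → anyV-false⁺ _ λ y → not-separated x y
    where
    not-separated : ∀ x y → allBut v x ∧ allBut v y ∧ reach G fullSet x y ∧ not (reach G (allBut v) x y) ≡ false
    not-separated x y with allBut v x in vx | allBut v y in vy
    ... | false | _ = refl
    ... | true | false = refl
    ... | true | true rewrite reach-v (allBut-∌ vx) (allBut-∌ vy) = ∧-zeroʳ _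

edgeList : Graph n → List (Fin n × Fin n)
edgeList {n} G =
  concatMap (λ i → map (i ,_) (filterᵇ (λ j → (toℕ i <ᵇ toℕ j) ∧ G i j) (allFin n))) (allFin n)

length-concatMap : ∀ (g : A → List B) xs → length (concatMap g xs) ≡ sum (map (length ∘ g) xs)
length-concatMap g [] = refl
length-concatMap g (x ∷ xs) = trans (length-++ (g x)) (cong (length (g x) +_) (length-concatMap g xs))

length-edgeList : ∀ (G : Graph n) → length (edgeList G) ≡ edgeCount G
length-edgeList {n} G = trans (length-concatMap _ (allFin n))
  (cong sum (map-cong (λ i → length-map (i ,_) (filterᵇ (λ j → (toℕ i <ᵇ toℕ j) ∧ G i j) (allFin n)))
                      (allFin n)))

∈-edgeList : ∀ (G : Graph n) {i j} → toℕ i < toℕ j → G i j ≡ true → (i , j) ∈ edgeList G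
∈-edgeList {n} G {i} {j} i<j Gij = ∈-concatMap⁺ _ {xs = allFin n} (Any.map (λ { refl →
  ∈-map⁺ (i ,_) (∈-filterᵇ⁺ (λ j → (toℕ i <ᵇ toℕ j) ∧ G i j) (∈-allFin j) (∧-intro (<⇒<ᵇ-true i<j) Gij)) })
  (∈-allFin i))

edge : Fin n → Fin n → Fin n × Fin n
edge x y = if toℕ x <ᵇ toℕ y then (x , y) else (y , x)

edge-injective : ∀ {x y x′ y′ : Fin n} → edge x y ≡ edge x′ y′ → (x ≡ x′ × y ≡ y′) ⊎ (x ≡ y′ × y ≡ x′)
edge-injective {x = x} {y} {x′} {y′} e with toℕ x <ᵇ toℕ y | toℕ x′ <ᵇ toℕ y′
... | true | true = inj₁ (cong proj₁ e , cong proj₂ e)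
... | true | false = inj₂ (cong proj₁ e , cong proj₂ e)
... | false | true = inj₂ (cong proj₂ e , cong proj₁ e)
... | false | false = inj₁ (cong proj₂ e , cong proj₁ e)

edge-∈ : ∀ {G : Graph n} → IsSimple G → ∀ {x y} → G x y ≡ true → edge x y ∈ edgeList G
edge-∈ {G = G} (G-sym , G-irrefl) {x} {y} Gxy with toℕ x <ᵇ toℕ y in x<y
... | true = ∈-edgeList G (<ᵇ-true⇒< (toℕ x) (toℕ y) x<y) Gxy
... | false = ∈-edgeList G (≤∧≢⇒< (<ᵇ-false⇒≥ x<y) y≢x) (trans (G-sym y x) Gxy)
  where
  y≢x : toℕ y ≢ toℕ x
  y≢x y≡x = true≢false (subst (λ z → G z y ≡ true) (toℕ-injective (sym y≡x)) Gxy) (G-irrefl y)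

-- Subtrees of a tree

connectedAt : Graph n → Fin n → Vec Bool n → Bool
connectedAt G v X = lookup X v ∧ connectedᵇ G (lookup X)

n∸1<n : Fin n → n ∸ 1 < n
n∸1<n {suc n} _ = ≤-refl

module Tree (T : Graph n) (tree : IsTree T) where

  open Walks T

  T-simple : IsSimple T
  T-simple = proj₁ tree

  open Symmetric (proj₁ T-simple)

  walk-anywhere : ∀ x y → Walk fullSet x n y
  walk-anywhere x y = connected-elim (proj₁ (proj₂ tree)) refl refl

  adjacent⇒≢ : ∀ {x y} → T x y ≡ true → x ≢ y
  adjacent⇒≢ {x} Txy refl = true≢false Txy (proj₂ T-simple x)

  -- Otherwise a breadth-first spanning tree of T - w, together with the edges wa and wb,
  -- would give n distinct edges in a tree with n - 1 edges.
  two-neighbours⇒cut : ∀ {w a b} → T w a ≡ true → T w b ≡ true → a ≢ b → isCutVertex T w ≡ true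
  two-neighbours⇒cut {w} {a} {b} Twa Twb a≢b with isCutVertex T w in cut?
  ... | true = refl
  ... | false = ⊥-elim (<⇒≱ (n∸1<n w) (begin
      n                        ≤⟨ n≤length-spanning ⟩
      length spanning          ≤⟨ unique-⊆⇒length≤ spanning-unique spanning⊆edges ⟩
      length (edgeList T)      ≡⟨ length-edgeList T ⟩
      edgeCount T              ≡⟨ proj₂ (proj₂ tree) ⟩
      n ∸ 1                    ∎))
    where
    open ≤-Reasoning
    a≢w : a ≢ w
    a≢w = adjacent⇒≢ Twa ∘ sym

    from-a : ∀ {y} → allBut w y ≡ true → Walk (allBut w) a n y
    from-a {y} y≠w = walk (nonCut-elim T cut? a≢w (allBut-∌ y≠w) (Walk.holds (walk-anywhere a y)))

    open Levels (allBut w) a from-a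

    others : List (Fin n)
    others = filterᵇ (λ y → allBut w y ∧ allBut a y) (allFin n)

    other⁻ : ∀ {y} → y ∈ others → y ≢ w × y ≢ a
    other⁻ {y} y∈ = let _ , p = ∈-filterᵇ⁻ (λ y → allBut w y ∧ allBut a y) {xs = allFin n} y∈
                        y≠w , y≠a = ∧-elim (allBut w y) p
                    in allBut-∌ y≠w , allBut-∌ y≠a

    parent-of-other : ∀ {y} → y ∈ others →
                      T (parent y) y ≡ true × allBut w (parent y) ≡ true × level (parent y) < level y
    parent-of-other y∈ = let y≢w , y≢a = other⁻ y∈ in parent-spec (allBut-∋ y≢w) y≢a

    tree-edge : Fin n → Fin n × Fin n
    tree-edge y = edge y (parent y)

    spanning : List (Fin n × Fin n)
    spanning = map tree-edge others ++ edge w a ∷ edge w b ∷ []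

    n≤length-spanning : n ≤ length spanning
    n≤length-spanning = begin
      n                                      ≡⟨ countV-true ⟨
      countV {n} (λ _ → true)                ≤⟨ countV-remove (λ _ → true) w ⟩
      suc (countV (allBut w))                ≤⟨ s≤s (countV-remove (allBut w) a) ⟩
      suc (suc (length others))              ≡⟨ +-comm 2 _ ⟩
      length others + 2                      ≡⟨ cong (_+ 2) (length-map tree-edge others) ⟨
      length (map tree-edge others) + 2      ≡⟨ length-++ (map tree-edge others) ⟨
      length spanning                        ∎

    tree-edge-injective : ∀ {y y′} → y ∈ others → y′ ∈ others → tree-edge y ≡ tree-edge y′ → y ≡ y′
    tree-edge-injective {y} {y′} y∈ y′∈ e with edge-injective e
    ... | inj₁ (y≡y′ , _) = y≡y′
    ... | inj₂ (y≡py′ , py≡y′) = ⊥-elim (<-asym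
      (subst (λ z → level z < level y′) (sym y≡py′) (proj₂ (proj₂ (parent-of-other y′∈))))
      (subst (λ z → level z < level y) py≡y′ (proj₂ (proj₂ (parent-of-other y∈)))))

    wa≢wb : edge w a ≢ edge w b
    wa≢wb e with edge-injective e
    ... | inj₁ (_ , a≡b) = a≢b a≡b
    ... | inj₂ (_ , a≡w) = a≢w a≡w

    tree-edge≢w-edge : ∀ {y c} → y ∈ others → tree-edge y ≢ edge w c
    tree-edge≢w-edge {y} y∈ e with edge-injective e
    ... | inj₁ (y≡w , _) = proj₁ (other⁻ y∈) y≡w
    ... | inj₂ (_ , py≡w) = true≢false (proj₁ (proj₂ (parent-of-other y∈)))
                                       (subst (λ z → allBut w z ≡ false) (sym py≡w) (allBut-self w))

    spanning-unique : Unique spanning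
    spanning-unique = ++⁺
      (unique-map-on tree-edge tree-edge-injective (filter⁺ _ (allFin⁺ n)))
      ((wa≢wb ∷ []) ∷ [] ∷ [])
      λ (z∈trees , z∈w-edges) → let y , y∈ , z≡ = ∈-map⁻ tree-edge z∈trees in case z∈w-edges y∈ z≡
      where
      case : ∀ {z y} → z ∈ edge w a ∷ edge w b ∷ [] → y ∈ others → z ≡ tree-edge y → ⊥
      case (here refl) y∈ e = tree-edge≢w-edge y∈ (sym e)
      case (there (here refl)) y∈ e = tree-edge≢w-edge y∈ (sym e)

    spanning⊆edges : ∀ {e} → e ∈ spanning → e ∈ edgeList T
    spanning⊆edges e∈ with ∈-++⁻ (map tree-edge others) e∈
    ... | inj₂ (here refl) = edge-∈ T-simple Twa
    ... | inj₂ (there (here refl)) = edge-∈ T-simple Twb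
    ... | inj₁ e∈trees with ∈-map⁻ tree-edge e∈trees
    ... | y , y∈ , refl = edge-∈ T-simple (trans (proj₁ T-simple y (parent y)) (proj₁ (parent-of-other y∈)))

  cutsAnd : Fin n → Fin n → Bool
  cutsAnd v i = isCutVertex T i ∨ ⌊ i ≟ v ⌋

  module _ (v : Fin n) where

    open Levels fullSet v (λ {y} _ → walk-anywhere v y)

    nonroot-parent-is-cut : ∀ {y} → y ≢ v → parent y ≢ v → isCutVertex T (parent y) ≡ true
    nonroot-parent-is-cut {y} y≢v p≢v = two-neighbours⇒cut Tpy (trans (proj₁ T-simple p (parent p)) Tppp) y≢pp
      where
      p : Fin n
      p = parent y
      Tpy : T p y ≡ true
      Tpy = proj₁ (parent-spec refl y≢v)
      Tppp : T (parent p) p ≡ true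
      Tppp = proj₁ (parent-spec refl p≢v)
      y≢pp : y ≢ parent p
      y≢pp y≡pp = <-asym (proj₂ (proj₂ (parent-spec refl y≢v)))
                         (subst (λ z → level z < level p) (sym y≡pp) (proj₂ (proj₂ (parent-spec refl p≢v))))

    superset-connected : ∀ X → cutsAnd v ⊆ᵇ X ≡ true → connectedAt T v X ≡ true
    superset-connected X required = ∧-intro Xv (connected-from-root λ {y} Xy →
      walk-mono (level≤n y) (tree-walk n y (level≤n y) Xy))
      where
      Xv : lookup X v ≡ true
      Xv = ⊆ᵇ-sound X required v (∨-introʳ (isCutVertex T v) (≡⇒≟-true refl))

      parent-∈ : ∀ {y} → y ≢ v → lookup X (parent y) ≡ true
      parent-∈ {y} y≢v with parent y ≟ v
      ... | yes p≡v = subst (λ z → lookup X z ≡ true) (sym p≡v) Xv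
      ... | no p≢v = ⊆ᵇ-sound X required (parent y) (∨-introˡ _ (nonroot-parent-is-cut y≢v p≢v))

      tree-walk : ∀ m y → level y ≤ m → lookup X y ≡ true → Walk (lookup X) v (level y) y
      tree-walk m y _ Xy with y ≟ v
      ... | yes refl = walk-mono z≤n (walk-refl Xv)
      ... | no y≢v with parent-spec refl y≢v
      tree-walk zero y ly≤0 _ | no _ | _ , _ , lp<ly = ⊥-elim (<⇒≱ lp<ly (≤-trans ly≤0 z≤n))
      tree-walk (suc m) y ly≤m Xy | no y≢v | Tpy , _ , lp<ly =
        walk-mono lp<ly
          (walk-snoc (tree-walk m (parent y) (≤-pred (≤-trans lp<ly ly≤m)) (parent-∈ y≢v)) Tpy Xy)

    component : Fin n → VSet n
    component c = reach T (allBut c) v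

    componentᵛ : Fin n → Vec Bool n
    componentᵛ c = Vec.tabulate (component c)

    component-root : ∀ {c} → c ≢ v → component c v ≡ true
    component-root c≢v = walk⇒reach _ v (walk-refl (allBut-∋ (c≢v ∘ sym)))

    component-avoids : ∀ c → component c c ≡ false
    component-avoids c = ¬-not λ e → true≢false (walk-endpoint (walk {allBut c} {v} {n} e)) (allBut-self c)

    component-connected : ∀ {c} → c ≢ v → connectedAt T v (componentᵛ c) ≡ true
    component-connected {c} c≢v = ∧-intro (trans (lookup∘tabulate _ v) (component-root c≢v))
      (connected-from-root λ {y} Ky → walk-restrict (lookup (componentᵛ c))
        (λ {_} {z} w → trans (lookup∘tabulate _ z) (walk⇒reach _ _ w))
        (walk (trans (sym (lookup∘tabulate _ y)) Ky)))

    -- Were the components of T - c and T - c′ equal, that of T - c would be closed under every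
    -- edge of T.
    componentᵛ-injective : ∀ {c c′} → c ≢ v → componentᵛ c ≡ componentᵛ c′ → c ≡ c′
    componentᵛ-injective {c} {c′} c≢v same with c ≟ c′
    ... | yes c≡c′ = c≡c′
    ... | no c≢c′ = ⊥-elim (true≢false
      (walk-invariant (component c) (component-root c≢v) closed (walk-anywhere v c))
      (component-avoids c))
      where
      same-at : ∀ y → component c y ≡ component c′ y
      same-at y = trans (sym (lookup∘tabulate _ y)) (trans (cong (λ K → lookup K y) same) (lookup∘tabulate _ y))

      extend : ∀ {d z u} → component d z ≡ true → T z u ≡ true → u ≢ d → component d u ≡ true
      extend {d} {z} Kz Tzu u≢d = walk⇒reach _ _ (walk-snoc (walk {allBut d} {v} {n} {z} Kz) Tzu (allBut-∋ u≢d))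

      closed : ∀ z u → component c z ≡ true → T z u ≡ true → fullSet u ≡ true → component c u ≡ true
      closed z u Kz Tzu _ with u ≟ c
      ... | no u≢c = extend Kz Tzu u≢c
      ... | yes refl = trans (same-at u) (extend (trans (sym (same-at z)) Kz) Tzu c≢c′)

    nonrootCut : Fin n → Bool
    nonrootCut c = isCutVertex T c ∧ not ⌊ c ≟ v ⌋

    count-supersets : 2 ^ (n ∸ countV (cutsAnd v)) ≤ countSubsets (λ X → connectedAt T v X ∧ cutsAnd v ⊆ᵇ X)
    count-supersets = ≤-trans (≤-reflexive (sym (countSubsets-⊇ (cutsAnd v))))
      (count-mono _ _ (allVecs n) λ X required → ∧-intro (superset-connected X required) required)

    count-components : countV nonrootCut ≤ countSubsets (λ X → connectedAt T v X ∧ not (cutsAnd v ⊆ᵇ X))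
    count-components = ≤-trans (≤-reflexive (sym (length-map componentᵛ nonrootCuts)))
      (length≤count _ (map componentᵛ nonrootCuts)
        (unique-map-on componentᵛ (λ c∈ _ → componentᵛ-injective (nonroot c∈)) (filter⁺ _ (allFin⁺ n)))
        component-counted)
      where
      nonrootCuts : List (Fin n)
      nonrootCuts = filterᵇ nonrootCut (allFin n)

      nonroot : ∀ {c} → c ∈ nonrootCuts → c ≢ v
      nonroot c∈ c≡v = let _ , p = ∈-filterᵇ⁻ nonrootCut {xs = allFin n} c∈ in
        true≢false (proj₂ (∧-elim (isCutVertex T _) p)) (cong not (≡⇒≟-true c≡v))

      component-counted : ∀ {K} → K ∈ map componentᵛ nonrootCuts →
                          K ∈ allVecs n × connectedAt T v K ∧ not (cutsAnd v ⊆ᵇ K) ≡ true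
      component-counted K∈ with ∈-map⁻ componentᵛ K∈
      ... | c , c∈ , refl = ∈-allVecs _ , ∧-intro (component-connected (nonroot c∈)) (cong not misses-c)
        where
        c-cut : isCutVertex T c ≡ true
        c-cut = proj₁ (∧-elim (isCutVertex T c) (proj₂ (∈-filterᵇ⁻ nonrootCut {xs = allFin n} c∈)))
        misses-c : cutsAnd v ⊆ᵇ componentᵛ c ≡ false
        misses-c = ¬-not λ e → true≢false
          (trans (sym (lookup∘tabulate _ c)) (⊆ᵇ-sound _ e c (∨-introˡ _ c-cut)))
          (component-avoids c)

    f-lower-bound : 2 ^ (n ∸ countV (cutsAnd v)) + countV nonrootCut ≤ f T v
    f-lower-bound = begin
      2 ^ (n ∸ countV (cutsAnd v)) + countV nonrootCut
        ≤⟨ +-mono-≤ count-supersets count-components ⟩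
      countSubsets (λ X → connectedAt T v X ∧ cutsAnd v ⊆ᵇ X)
        + countSubsets (λ X → connectedAt T v X ∧ not (cutsAnd v ⊆ᵇ X))
        ≡⟨ count-partition (connectedAt T v) (cutsAnd v ⊆ᵇ_) (allVecs n) ⟨
      f T v ∎
      where open ≤-Reasoning

-- If v is itself a cut vertex (k = c + 1), the extra factor 2 in the supersets pays for the
-- missing component.
2^[n∸k∸1]+k≤2^[n∸suc[c]]+c : ∀ {n k c} → c ≤ k → k ≤ suc c → k < n →
                             2 ^ (n ∸ k ∸ 1) + k ≤ 2 ^ (n ∸ suc c) + c
2^[n∸k∸1]+k≤2^[n∸suc[c]]+c {n} {k} {c} c≤k k≤1+c k<n with m≤n⇒m<n∨m≡n c≤k
... | inj₂ refl = ≤-reflexive (cong (λ e → 2 ^ e + c) (trans (∸-+-assoc n c 1) (cong (n ∸_) (+-comm c 1))))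
... | inj₁ c<k with ≤-antisym k≤1+c c<k
... | refl = begin
  2 ^ m + suc c       ≡⟨ +-suc (2 ^ m) c ⟩
  suc (2 ^ m) + c     ≤⟨ +-monoˡ-≤ c (+-monoˡ-≤ (2 ^ m) (m^n>0 2 m)) ⟩
  2 ^ m + 2 ^ m + c   ≡⟨ cong (λ e → 2 ^ m + e + c) (+-identityʳ (2 ^ m)) ⟨
  2 ^ suc m + c       ≡⟨ cong (λ e → 2 ^ e + c) (m+[n∸m]≡n (m<n⇒0<n∸m k<n)) ⟩
  2 ^ (n ∸ suc c) + c ∎
  where
  open ≤-Reasoning
  m : ℕ
  m = n ∸ suc c ∸ 1

tree-f-lower-bound : ∀ (T : Graph n) → IsTree T → ∀ {k} → numCutVertices T ≡ k → k < n →
                     ∀ v → 2 ^ (n ∸ k ∸ 1) + k ≤ f T v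
tree-f-lower-bound {n} T tree {k} refl k<n v = begin
  2 ^ (n ∸ k ∸ 1) + k                  ≤⟨ 2^[n∸k∸1]+k≤2^[n∸suc[c]]+c c≤k k≤1+c k<n ⟩
  2 ^ (n ∸ suc c) + c                  ≤⟨ +-monoˡ-≤ c (^-monoʳ-≤ 2 (∸-monoʳ-≤ n required≤1+c)) ⟩
  2 ^ (n ∸ countV (cutsAnd v)) + c     ≤⟨ f-lower-bound v ⟩
  f T v                                ∎
  where
  open ≤-Reasoning
  open Tree T tree
  c : ℕ
  c = countV (nonrootCut v)
  c≤k : c ≤ k
  c≤k = count-mono _ _ (allFin n) λ i e → proj₁ (∧-elim (isCutVertex T i) e)
  k≤1+c : k ≤ suc c
  k≤1+c = countV-remove (isCutVertex T) v
  required≤1+c : countV (cutsAnd v) ≤ suc c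
  required≤1+c = ≤-trans (countV-remove (cutsAnd v) v)
    (≤-reflexive (cong suc (count-cong _ _ (allFin n) λ i → absorb (isCutVertex T i) ⌊ i ≟ v ⌋)))
    where
    absorb : ∀ a b → (a ∨ b) ∧ not b ≡ a ∧ not b
    absorb a true = trans (∧-zeroʳ _) (sym (∧-zeroʳ a))
    absorb a false = cong (_∧ true) (∨-identityʳ a)

-- The path-star tree

pathEdgeᵇ starEdgeᵇ pathStarᵇ : ℕ → ℕ → ℕ → Bool
pathEdgeᵇ k a b = (a <ᵇ suc k) ∧ (b <ᵇ suc k) ∧ ((suc a ≡ᵇ b) ∨ (suc b ≡ᵇ a))
starEdgeᵇ k a b = (a ≡ᵇ k) ∧ not (b <ᵇ suc k)
-- pathStar n (suc k) i j computes to pathStarᵇ k (toℕ i) (toℕ j).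
pathStarᵇ k a b = pathEdgeᵇ k a b ∨ starEdgeᵇ k a b ∨ starEdgeᵇ k b a

data PathStarEdge (k : ℕ) : ℕ → ℕ → Set where
  path⁺ : ∀ {a} → a < k → PathStarEdge k a (suc a)
  path⁻ : ∀ {a} → a < k → PathStarEdge k (suc a) a
  leaf⁺ : ∀ {b} → k < b → PathStarEdge k k b
  leaf⁻ : ∀ {b} → k < b → PathStarEdge k b k

pathStarᵇ-complete : ∀ {k a b} → PathStarEdge k a b → pathStarᵇ k a b ≡ true
pathStarᵇ-complete {a = a} (path⁺ a<k) = ∨-introˡ _
  (∧-intro (<⇒<ᵇ-true (m≤n⇒m≤1+n a<k)) (∧-intro (<⇒<ᵇ-true (s<s a<k)) (∨-introˡ _ (≡ᵇ-refl a))))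
pathStarᵇ-complete {b = b} (path⁻ b<k) = ∨-introˡ _
  (∧-intro (<⇒<ᵇ-true (s<s b<k)) (∧-intro (<⇒<ᵇ-true (m≤n⇒m≤1+n b<k)) (∨-introʳ (suc (suc b) ≡ᵇ b) (≡ᵇ-refl b))))
pathStarᵇ-complete {k} {b = b} (leaf⁺ k<b) = ∨-introʳ (pathEdgeᵇ k k b)
  (∨-introˡ _ (∧-intro (≡ᵇ-refl k) (cong not (≥⇒<ᵇ-false k<b))))
pathStarᵇ-complete {k} {a} (leaf⁻ k<a) = ∨-introʳ (pathEdgeᵇ k a k) (∨-introʳ (starEdgeᵇ k a k)
  (∧-intro (≡ᵇ-refl k) (cong not (≥⇒<ᵇ-false k<a))))

pathStarᵇ-sound : ∀ {k a b} → pathStarᵇ k a b ≡ true → PathStarEdge k a b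
pathStarᵇ-sound {k} {a} {b} e with ∨-elim (pathEdgeᵇ k a b) e
... | inj₁ on-path with ∧-elim (a <ᵇ suc k) on-path
... | a≤k , rest with ∧-elim (b <ᵇ suc k) rest
... | b≤k , adjacent with ∨-elim (suc a ≡ᵇ b) adjacent
... | inj₁ b≡1+a with ≡ᵇ-true⇒≡ (suc a) b b≡1+a
... | refl = path⁺ (s<s⁻¹ (<ᵇ-true⇒< b (suc k) b≤k))
pathStarᵇ-sound {k} {a} {b} e | inj₁ _ | a≤k , _ | _ , _ | inj₂ a≡1+b with ≡ᵇ-true⇒≡ (suc b) a a≡1+b
... | refl = path⁻ (s<s⁻¹ (<ᵇ-true⇒< a (suc k) a≤k))
pathStarᵇ-sound {k} {a} {b} e | inj₂ star with ∨-elim (starEdgeᵇ k a b) star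
... | inj₁ out with ∧-elim (a ≡ᵇ k) out
... | a≡k , b>k with ≡ᵇ-true⇒≡ a k a≡k
... | refl = leaf⁺ (<ᵇ-false⇒≥ (not-injective b>k))
pathStarᵇ-sound {k} {a} {b} e | inj₂ _ | inj₂ into with ∧-elim (b ≡ᵇ k) into
... | b≡k , a>k with ≡ᵇ-true⇒≡ b k b≡k
... | refl = leaf⁻ (<ᵇ-false⇒≥ (not-injective a>k))

pathStarEdge-sym : ∀ {k a b} → PathStarEdge k a b → PathStarEdge k b a
pathStarEdge-sym (path⁺ a<k) = path⁻ a<k
pathStarEdge-sym (path⁻ b<k) = path⁺ b<k
pathStarEdge-sym (leaf⁺ k<b) = leaf⁻ k<b
pathStarEdge-sym (leaf⁻ k<a) = leaf⁺ k<a

pathStarEdge-irrefl : ∀ {k a} → ¬ PathStarEdge k a a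
pathStarEdge-irrefl (leaf⁺ k<k) = <-irrefl refl k<k
pathStarEdge-irrefl (leaf⁻ k<k) = <-irrefl refl k<k

pathStarEdge-below : ∀ {k a b t} → PathStarEdge k a b → a < t → t ≤ k → b ≢ t → b < t
pathStarEdge-below (path⁺ _) a<t _ b≢t = ≤∧≢⇒< a<t b≢t
pathStarEdge-below (path⁻ _) a<t _ _ = <-trans (n<1+n _) a<t
pathStarEdge-below (leaf⁺ _) k<t t≤k _ = ⊥-elim (<⇒≱ k<t t≤k)
pathStarEdge-below (leaf⁻ k<a) a<t t≤k _ = ⊥-elim (<-asym k<a (<-≤-trans a<t t≤k))

module PathStar (n k : ℕ) (k<n : k < n) {v₀ : Fin n} (v₀≡0 : toℕ v₀ ≡ 0) where

  G : Graph n
  G = pathStar n (suc k)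

  open Walks G

  edge⁻ : ∀ {i j} → G i j ≡ true → PathStarEdge k (toℕ i) (toℕ j)
  edge⁻ {i} {j} = pathStarᵇ-sound {k} {toℕ i} {toℕ j}

  edge⁺ : ∀ {i j a b} → toℕ i ≡ a → toℕ j ≡ b → PathStarEdge k a b → G i j ≡ true
  edge⁺ refl refl = pathStarᵇ-complete

  simple : IsSimple G
  simple = (λ i j → true⇔true⇒≡ (edge⁺ refl refl ∘ pathStarEdge-sym ∘ edge⁻ {i} {j})
                               (edge⁺ refl refl ∘ pathStarEdge-sym ∘ edge⁻ {j} {i}))
         , (λ i → ¬-not (pathStarEdge-irrefl ∘ edge⁻ {i} {i}))

  open Symmetric (proj₁ simple)

  path-walk : ∀ {S x} t {y} → toℕ x ≤ t → toℕ y ≡ t → t ≤ k →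
              (∀ u → toℕ x ≤ toℕ u → toℕ u ≤ t → S u ≡ true) → Σ ℕ λ j → Walk S x j y
  path-walk {S} {x} t x≤t y≡t t≤k inS with m≤n⇒m<n∨m≡n x≤t
  ... | inj₂ x≡t = 0 , subst (Walk S x 0) (toℕ-injective (trans x≡t (sym y≡t))) (walk-refl (inS x ≤-refl x≤t))
  path-walk {S} {x} (suc t) {y} x≤1+t y≡1+t t<k inS | inj₁ (s≤s x≤t) =
    let j , w = path-walk t x≤t (toℕ-fromℕ< t<n) (<⇒≤ t<k) (λ u x≤u u≤t → inS u x≤u (m≤n⇒m≤1+n u≤t)) in
    suc j , walk-snoc w (edge⁺ (toℕ-fromℕ< t<n) y≡1+t (path⁺ t<k))
                        (inS _ (≤-trans x≤1+t (≤-reflexive (sym y≡1+t))) (≤-reflexive y≡1+t))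
    where
    t<n : t < n
    t<n = <-trans t<k k<n

  walk-from : ∀ {S r} → toℕ r ≤ k → (∀ u → toℕ r ≤ toℕ u → toℕ u ≤ k → S u ≡ true) →
              ∀ {y} → S y ≡ true → toℕ r ≤ toℕ y → Walk S r n y
  walk-from {S} {r} r≤k inS {y} Sy r≤y with toℕ y ≤? k
  ... | yes y≤k = let _ , w = path-walk (toℕ y) r≤y refl y≤k (λ u r≤u u≤y → inS u r≤u (≤-trans u≤y y≤k)) in
                  walk (walk⇒reach S r w)
  ... | no y≰k = let _ , w = path-walk k r≤k (toℕ-fromℕ< k<n) ≤-refl inS in
                 walk (walk⇒reach S r (walk-snoc w (edge⁺ (toℕ-fromℕ< k<n) refl (leaf⁺ (≰⇒> y≰k))) Sy))

  v₀≤ : ∀ (y : Fin n) → toℕ v₀ ≤ toℕ y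
  v₀≤ y = subst (_≤ toℕ y) (sym v₀≡0) z≤n

  v₀≤k : toℕ v₀ ≤ k
  v₀≤k = subst (_≤ k) (sym v₀≡0) z≤n

  walk-from-v₀ : ∀ y → Walk fullSet v₀ n y
  walk-from-v₀ y = walk-from v₀≤k (λ _ _ _ → refl) {y} refl (v₀≤ y)

  row : ℕ → ℕ
  row a = sumBelow (λ b → bit ((a <ᵇ b) ∧ pathStarᵇ k a b)) n

  forward-edge : ∀ a b → (a <ᵇ b) ∧ pathStarᵇ k a b ≡ true → (a < k × b ≡ suc a) ⊎ (a ≡ k × k < b)
  forward-edge a b e with ∧-elim (a <ᵇ b) e
  ... | a<b , ab with pathStarᵇ-sound {k} {a} {b} ab
  ... | path⁺ a<k = inj₁ (a<k , refl)
  ... | path⁻ _ = ⊥-elim (<-asym (<ᵇ-true⇒< a b a<b) (n<1+n b))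
  ... | leaf⁺ k<b = inj₂ (refl , k<b)
  ... | leaf⁻ k<a = ⊥-elim (<-asym (<ᵇ-true⇒< a b a<b) k<a)

  row-path : ∀ a → a < k → row a ≡ 1
  row-path a a<k = trans (sumBelow-cong n λ b _ → cong bit (true⇔true⇒≡ (next⁺ {b}) (next⁻ {b})))
                         (sumBelow-≡ᵇ (≤-trans (s≤s a<k) k<n))
    where
    next⁺ : ∀ {b} → (a <ᵇ b) ∧ pathStarᵇ k a b ≡ true → (b ≡ᵇ suc a) ≡ true
    next⁺ {b} e with forward-edge a b e
    ... | inj₁ (_ , refl) = ≡ᵇ-refl (suc a)
    ... | inj₂ (refl , _) = ⊥-elim (<-irrefl refl a<k)
    next⁻ : ∀ {b} → (b ≡ᵇ suc a) ≡ true → (a <ᵇ b) ∧ pathStarᵇ k a b ≡ true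
    next⁻ {b} e with ≡ᵇ-true⇒≡ b (suc a) e
    ... | refl = ∧-intro (<⇒<ᵇ-true (n<1+n a)) (pathStarᵇ-complete (path⁺ a<k))

  row-centre : row k ≡ n ∸ suc k
  row-centre = trans (sumBelow-cong n λ b _ → cong bit (true⇔true⇒≡ (leaf⁺′ {b}) (leaf⁻′ {b}))) (sumBelow->ᵇ k n)
    where
    leaf⁺′ : ∀ {b} → (k <ᵇ b) ∧ pathStarᵇ k k b ≡ true → (k <ᵇ b) ≡ true
    leaf⁺′ {b} e = proj₁ (∧-elim (k <ᵇ b) e)
    leaf⁻′ : ∀ {b} → (k <ᵇ b) ≡ true → (k <ᵇ b) ∧ pathStarᵇ k k b ≡ true
    leaf⁻′ {b} e = ∧-intro e (pathStarᵇ-complete (leaf⁺ (<ᵇ-true⇒< k b e)))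

  row-leaf : ∀ a → k < a → row a ≡ 0
  row-leaf a k<a = sumBelow-zero n λ b → cong bit (¬-not λ e → case (forward-edge a b e))
    where
    case : ∀ {b} → (a < k × b ≡ suc a) ⊎ (a ≡ k × k < b) → ⊥
    case (inj₁ (a<k , _)) = <-asym a<k k<a
    case (inj₂ (refl , _)) = <-irrefl refl k<a

  edgeCount-pathStar : edgeCount G ≡ n ∸ 1
  edgeCount-pathStar = begin
    edgeCount G
      ≡⟨ cong sum (map-cong (λ i → countV-toℕ n (λ b → (toℕ i <ᵇ b) ∧ pathStarᵇ k (toℕ i) b)) (allFin n)) ⟩
    sum (map (row ∘ toℕ) (allFin n)) ≡⟨ sum-allFin-toℕ n row ⟩
    sumBelow row n                   ≡⟨ sumBelow-shape k<n row-path row-centre row-leaf ⟩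
    k + (n ∸ suc k)                  ≡⟨ cong pred (m+[n∸m]≡n k<n) ⟩
    pred n                           ≡⟨ pred[m∸n]≡m∸[1+n] n 0 ⟩
    n ∸ 1                            ∎
    where open ≡-Reasoning

  isTree : IsTree G
  isTree = simple , connected-from-root (λ {y} _ → walk-from-v₀ y) , edgeCount-pathStar

  walk-below : ∀ {S t j y} → 0 < t → t ≤ k → (∀ u → S u ≡ true → toℕ u ≢ t) → Walk S v₀ j y → toℕ y < t
  walk-below {S} {t} {y = y} 0<t t≤k avoids w = <ᵇ-true⇒< (toℕ y) t (walk-invariant (λ z → toℕ z <ᵇ t)
    (subst (λ a → (a <ᵇ t) ≡ true) (sym v₀≡0) (<⇒<ᵇ-true 0<t))
    (λ z u z<t Gzu Su →
      <⇒<ᵇ-true (pathStarEdge-below (edge⁻ Gzu) (<ᵇ-true⇒< (toℕ z) t z<t) t≤k (avoids u Su)))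
    w)

  cut-path : ∀ {i} → 0 < toℕ i → toℕ i ≤ k → suc k < n → isCutVertex G i ≡ true
  cut-path {i} 0<i i≤k 1+k<n = cut-intro G v₀≢i last≢i (Walk.holds (walk-from-v₀ last)) separated
    where
    last : Fin n
    last = Fin.fromℕ< (n∸1<n v₀)
    k<last : k < toℕ last
    k<last = subst (k <_) (trans (pred[m∸n]≡m∸[1+n] n 0) (sym (toℕ-fromℕ< (n∸1<n v₀))))
                   (suc[m]≤n⇒m≤pred[n] 1+k<n)
    v₀≢i : v₀ ≢ i
    v₀≢i v₀≡i = <⇒≢ 0<i (trans (sym v₀≡0) (cong toℕ v₀≡i))
    last≢i : last ≢ i
    last≢i last≡i = <⇒≱ k<last (subst (_≤ k) (cong toℕ (sym last≡i)) i≤k)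
    separated : reach G (allBut i) v₀ last ≡ false
    separated = ¬-not λ r → <⇒≱
      (walk-below 0<i i≤k (λ u u≠i → allBut-∌ u≠i ∘ toℕ-injective) (walk {allBut i} {v₀} {n} {last} r))
      (<⇒≤ (≤-<-trans i≤k k<last))

  nonCut-origin : ∀ {i} → toℕ i ≡ 0 → 0 < k → isCutVertex G i ≡ false
  nonCut-origin {i} i≡0 0<k = nonCut-intro G λ x≢i y≢i →
    reach-via-root (λ y≠i → walk-from 1≤k (λ u 1≤u _ → off-origin 1≤u) y≠i (one≤ y≠i))
                   (allBut-∋ x≢i) (allBut-∋ y≢i)
    where
    one : Fin n
    one = Fin.fromℕ< (≤-<-trans 0<k k<n)
    1≤k : toℕ one ≤ k
    1≤k = subst (_≤ k) (sym (toℕ-fromℕ< (≤-<-trans 0<k k<n))) 0<k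
    off-origin : ∀ {u} → toℕ one ≤ toℕ u → allBut i u ≡ true
    off-origin {u} 1≤u = allBut-∋ λ u≡i →
      <⇒≢ (subst (_≤ toℕ u) (toℕ-fromℕ< (≤-<-trans 0<k k<n)) 1≤u) (sym (trans (cong toℕ u≡i) i≡0))
    one≤ : ∀ {y} → allBut i y ≡ true → toℕ one ≤ toℕ y
    one≤ {y} y≠i = subst (_≤ toℕ y) (sym (toℕ-fromℕ< (≤-<-trans 0<k k<n)))
      (n≢0⇒n>0 λ y≡0 → allBut-∌ y≠i (toℕ-injective (trans y≡0 (sym i≡0))))

  nonCut-leaf : ∀ {i} → k < toℕ i → isCutVertex G i ≡ false
  nonCut-leaf {i} k<i = nonCut-intro G λ x≢i y≢i →
    reach-via-root (λ {y} y≠i → walk-from v₀≤k (λ u _ u≤k → on-path u≤k) y≠i (v₀≤ y))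
                   (allBut-∋ x≢i) (allBut-∋ y≢i)
    where
    on-path : ∀ {u} → toℕ u ≤ k → allBut i u ≡ true
    on-path u≤k = allBut-∋ λ u≡i → <⇒≱ k<i (subst (_≤ k) (cong toℕ u≡i) u≤k)

  isCutVertex-pathStar : 0 < k → suc k < n → ∀ i → isCutVertex G i ≡ (0 <ᵇ toℕ i) ∧ (toℕ i <ᵇ suc k)
  isCutVertex-pathStar 0<k 1+k<n i with toℕ i in i≡
  ... | zero = nonCut-origin i≡ 0<k
  ... | suc t with t <? k
  ...   | yes t<k = trans (cut-path (subst (0 <_) (sym i≡) z<s) (subst (_≤ k) (sym i≡) t<k) 1+k<n)
                          (sym (<⇒<ᵇ-true t<k))
  ...   | no t≮k = trans (nonCut-leaf (subst (k <_) (sym i≡) (s≤s (≮⇒≥ t≮k)))) (sym (≥⇒<ᵇ-false (≮⇒≥ t≮k)))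

  numCutVertices-pathStar : 0 < k → suc k < n → numCutVertices G ≡ k
  numCutVertices-pathStar 0<k 1+k<n = begin
    countV (isCutVertex G)
      ≡⟨ count-cong _ _ (allFin n) (isCutVertex-pathStar 0<k 1+k<n) ⟩
    countV {n} (λ i → (0 <ᵇ toℕ i) ∧ (toℕ i <ᵇ suc k))
      ≡⟨ countV-toℕ n (λ a → (0 <ᵇ a) ∧ (a <ᵇ suc k)) ⟩
    sumBelow (λ a → bit ((0 <ᵇ a) ∧ (a <ᵇ suc k))) n
      ≡⟨ interior k<n ⟩
    k ∎
    where
    open ≡-Reasoning
    interior : ∀ {n} → k < n → sumBelow (λ a → bit ((0 <ᵇ a) ∧ (a <ᵇ suc k))) n ≡ k
    interior {suc n} (s≤s k≤n) = sumBelow-<ᵇ k≤n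

  pathPrefix : Fin n → Bool
  pathPrefix z = toℕ z <ᵇ suc k

  segment : ℕ → Vec Bool n
  segment j = Vec.tabulate λ z → toℕ z <ᵇ suc j

  -- The least vertex missing from X lies on the path, and X consists exactly of the vertices below it.
  initial-segment : ∀ X → connectedAt G v₀ X ≡ true → pathPrefix ⊆ᵇ X ≡ false → X ∈ map segment (upTo k)
  initial-segment X X-conn X⊉prefix with ⊈ᵇ-witness X X⊉prefix
  ... | i , i≤k , i∉X with least-missing (lookup X) i i∉X
  ... | m , m∉X , below-m∈X with toℕ m in m≡
  ... | zero = ⊥-elim (true≢false (proj₁ (∧-elim (lookup X v₀) X-conn))
                                  (subst (λ z → lookup X z ≡ false) (toℕ-injective (trans m≡ (sym v₀≡0))) m∉X))
  ... | suc j = subst (_∈ map segment (upTo k)) (sym X≡segment) (∈-map⁺ segment (∈-upTo⁺ j<k))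
    where
    j<k : j < k
    j<k = ≤-trans (≮⇒≥ λ i<m → true≢false (below-m∈X i i<m) i∉X) (s≤s⁻¹ (<ᵇ-true⇒< (toℕ i) (suc k) i≤k))
    m∉ : ∀ u → lookup X u ≡ true → toℕ u ≢ suc j
    m∉ u u∈X u≡ = true≢false u∈X (subst (λ z → lookup X z ≡ false) (toℕ-injective (trans m≡ (sym u≡))) m∉X)
    X≡segment : X ≡ segment j
    X≡segment = trans (sym (tabulate∘lookup X)) (tabulate-cong λ u → true⇔true⇒≡
      (λ u∈X → <⇒<ᵇ-true (walk-below z<s j<k m∉
        (connected-elim (proj₂ (∧-elim (lookup X v₀) X-conn)) (proj₁ (∧-elim (lookup X v₀) X-conn)) u∈X)))
      (λ u≤j → below-m∈X u (<ᵇ-true⇒< (toℕ u) (suc j) u≤j)))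

  f-v₀-upper-bound : f G v₀ ≤ 2 ^ (n ∸ k ∸ 1) + k
  f-v₀-upper-bound = begin
    f G v₀
      ≡⟨ count-partition (connectedAt G v₀) (pathPrefix ⊆ᵇ_) (allVecs n) ⟩
    countSubsets (λ X → connectedAt G v₀ X ∧ pathPrefix ⊆ᵇ X)
      + countSubsets (λ X → connectedAt G v₀ X ∧ not (pathPrefix ⊆ᵇ X))
      ≤⟨ +-mono-≤ (count-mono _ _ (allVecs n) λ X e → proj₂ (∧-elim (connectedAt G v₀ X) e))
                  (count≤length _ (map segment (upTo k)) (allVecs-unique n) λ {X} _ e →
                    let conn , ⊉ = ∧-elim (connectedAt G v₀ X) e in initial-segment X conn (not-injective ⊉)) ⟩
    countSubsets (pathPrefix ⊆ᵇ_) + length (map segment (upTo k))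
      ≡⟨ cong₂ _+_ (countSubsets-⊇ pathPrefix) (trans (length-map segment (upTo k)) (length-upTo k)) ⟩
    2 ^ (n ∸ countV pathPrefix) + k
      ≡⟨ cong (λ c → 2 ^ (n ∸ c) + k) (trans (countV-toℕ n (_<ᵇ suc k)) (sumBelow-<ᵇ k<n)) ⟩
    2 ^ (n ∸ suc k) + k
      ≡⟨ cong (λ e → 2 ^ e + k) (trans (cong (n ∸_) (+-comm 1 k)) (sym (∸-+-assoc n k 1))) ⟩
    2 ^ (n ∸ k ∸ 1) + k ∎
    where open ≤-Reasoning

k≤n∸3⇒suc[k]<n : ∀ {n k} → 1 ≤ k → k ≤ n ∸ 3 → suc k < n
k≤n∸3⇒suc[k]<n {zero} {suc _} _ ()
k≤n∸3⇒suc[k]<n {suc zero} {suc _} _ ()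
k≤n∸3⇒suc[k]<n {suc (suc zero)} {suc _} _ ()
k≤n∸3⇒suc[k]<n {suc (suc (suc n))} _ k≤n = s≤s (s≤s (m≤n⇒m≤1+n k≤n))

corollary3p14 : (n k : ℕ) → 1 ≤ k → k ≤ n ∸ 3 → (v₀ : Fin n) → toℕ v₀ ≡ 0 →
    InTnk n k (pathStar n (k + 1))
    × ((T : Graph n) → InTnk n k T → (v : Fin n) → f (pathStar n (k + 1)) v₀ ≤ f T v)
    × (f (pathStar n (k + 1)) v₀ ≡ 2 ^ (n ∸ k ∸ 1) + k)
corollary3p14 n k 1≤k k≤n∸3 v₀ v₀≡0 rewrite +-comm k 1 =
    (isTree , cuts)
  , (λ T (T-tree , T-cuts) v → ≤-trans f-v₀-upper-bound (tree-f-lower-bound T T-tree T-cuts k<n v))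
  , ≤-antisym f-v₀-upper-bound (tree-f-lower-bound G isTree cuts k<n v₀)
  where
  1+k<n : suc k < n
  1+k<n = k≤n∸3⇒suc[k]<n 1≤k k≤n∸3
  k<n : k < n
  k<n = <-trans (n<1+n k) 1+k<n
  open PathStar n k k<n v₀≡0
  cuts : numCutVertices G ≡ k
  cuts = numCutVertices-pathStar 1≤k 1+k<n
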